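{- Let $G$ be a graph, and let $I$ and $O$ be disjoint vertex sets such that $I$ is nonempty and both $G[I \cup O]$ and $G - (I \cup O)$ are edgeless. Then every minimal $(I,O)$-extension $S$ satisfies $|S| \leq |I \cup O|$.
   Context: All graphs are finite and simple. A vertex set $X$ is a connected dominating set of $G$ if every vertex not in $X$ has a neighbor in $X$ and $G[X]$ is connected. For disjoint vertex sets $I$ and $O$, an $(I,O)$-extension is a vertex set $S$ disjoint from $I \cup O$ such that $I \cup S$ is a connected dominating set of $G$; it is minimal if no proper subset of it is also an $(I,O)$-extension. -}

module Defs where

open import Data.Nat using (ℕ)
open import Data.Fin using (Fin)
open import Data.Fin.Subset using (Subset; _∈_; _∉_; _∪_; _∩_; _⊂_; Empty; Nonempty; ∣_∣)
open import Data.Product using (Σ; ∃; _×_; _,_)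
open import Relation.Nullary using (¬_; Dec)
open import Relation.Binary.PropositionalEquality using (_≡_)
open import Level using (0ℓ)

record Graph : Set₁ where
  field
    n      : ℕ
    Adj    : Fin n → Fin n → Set
    adj?   : ∀ u v → Dec (Adj u v)
    sym    : ∀ {u v} → Adj u v → Adj v u
    irrefl : ∀ {u} → ¬ Adj u u

open Graph public

data WalkIn (G : Graph) (X : Subset (n G)) : Fin (n G) → Fin (n G) → Set where
  here : ∀ {u} → u ∈ X → WalkIn G X u u
  step : ∀ {u w v} → u ∈ X → Adj G u w → WalkIn G X w v → WalkIn G X u v

Connected : (G : Graph) → Subset (n G) → Set
Connected G X = ∀ u v → u ∈ X → v ∈ X → WalkIn G X u v

Dominating : (G : Graph) → Subset (n G) → Set
Dominating G X = ∀ v → v ∉ X → ∃ λ u → u ∈ X × Adj G v u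

ConnectedDominating : (G : Graph) → Subset (n G) → Set
ConnectedDominating G X = Dominating G X × Connected G X

Disjoint : ∀ {m} → Subset m → Subset m → Set
Disjoint X Y = Empty (X ∩ Y)

EdgelessOn : (G : Graph) → Subset (n G) → Set
EdgelessOn G X = ∀ u v → u ∈ X → v ∈ X → ¬ Adj G u v

EdgelessOutside : (G : Graph) → Subset (n G) → Set
EdgelessOutside G X = ∀ u v → u ∉ X → v ∉ X → ¬ Adj G u v

Extension : (G : Graph) → (I O S : Subset (n G)) → Set
Extension G I O S = Disjoint S (I ∪ O) × ConnectedDominating G (I ∪ S)

MinimalExtension : (G : Graph) → (I O S : Subset (n G)) → Set
MinimalExtension G I O S =
  Extension G I O S × (∀ S' → S' ⊂ S → ¬ Extension G I O S')

-- G[I ∪ S] is bipartite with sides I and S, and every vertex outside I ∪ O has a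
-- neighbour in I. Starting from a vertex r ∈ I, grow C ⊆ I ∪ O together with B ⊆ S,
-- |B| ≤ |C|: a vertex a ∈ I ∪ O joins C along with one s ∈ S adjacent to a and to
-- I ∩ C, which keeps every vertex of B and of I ∩ C joined to r inside I ∪ B and every
-- vertex of O ∩ C dominated by B. Since I ∪ S is a connected dominating set, the
-- growth only stops at C = I ∪ O, when B ⊆ S is itself an (I,O)-extension; minimality
-- forces B = S, whence |S| ≤ |C| ≤ |I ∪ O|.
module Submission where

open import Defs
open import Data.Nat using (ℕ; zero; suc; _≤_; _<_; _+_; s≤s)
open import Data.Nat.Properties using (≤-refl; ≤-trans; +-suc; +-identityʳ; +-monoˡ-≤; <⇒≱; n≤1+n)
open import Data.Fin using (Fin)
open import Data.Fin.Subset using (Subset; _∈_; _∉_; _⊆_; _∪_; ⁅_⁆; ⊥; Nonempty; ∣_∣; inside; outside)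
open import Data.Fin.Subset.Properties
  using (_∈?_; x∈p∪q⁻; x∈p∩q⁺; x∈p∩q⁻; p⊆p∪q; q⊆p∪q; x∈⁅x⁆; x∈⁅y⁆⇒x≡y; ∉⊥; ⊥⊆; ∣⁅x⁆∣≡1; ∪-identityʳ; p⊆q⇒∣p∣≤∣q∣; p⊂q⇒∣p∣<∣q∣; ∣p∣≤n)
open import Data.Fin.Properties using (any?)
open import Data.Vec using (_∷_)
open import Data.Product using (∃; ∃₂; _×_; _,_; proj₁; proj₂)
open import Data.Sum using (inj₁; inj₂; [_,_])
open import Relation.Nullary using (¬_; Dec; yes; no; contradiction)
open import Relation.Nullary.Decidable using (_×-dec_; ¬?)
open import Relation.Binary.PropositionalEquality using (_≢_; refl; subst) renaming (sym to ≡-sym)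

private
  variable
    m : ℕ

∣p∪⁅x⁆∣≤1+∣p∣ : (p : Subset m) (x : Fin m) → ∣ p ∪ ⁅ x ⁆ ∣ ≤ suc ∣ p ∣
∣p∪⁅x⁆∣≤1+∣p∣ (inside  ∷ p) Fin.zero    rewrite ∪-identityʳ p = n≤1+n _
∣p∪⁅x⁆∣≤1+∣p∣ (outside ∷ p) Fin.zero    rewrite ∪-identityʳ p = ≤-refl
∣p∪⁅x⁆∣≤1+∣p∣ (inside  ∷ p) (Fin.suc x) = s≤s (∣p∪⁅x⁆∣≤1+∣p∣ p x)
∣p∪⁅x⁆∣≤1+∣p∣ (outside ∷ p) (Fin.suc x) = ∣p∪⁅x⁆∣≤1+∣p∣ p x

x∉p⇒∣p∣<∣p∪⁅x⁆∣ : {p : Subset m} {x : Fin m} → x ∉ p → ∣ p ∣ < ∣ p ∪ ⁅ x ⁆ ∣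
x∉p⇒∣p∣<∣p∪⁅x⁆∣ {p = p} {x} x∉p = p⊂q⇒∣p∣<∣q∣ (p⊆p∪q ⁅ x ⁆ , x , q⊆p∪q p ⁅ x ⁆ (x∈⁅x⁆ x) , x∉p)

y∈p∪⁅y⁆ : {p : Subset m} {y : Fin m} → y ∈ p ∪ ⁅ y ⁆
y∈p∪⁅y⁆ {p = p} {y} = q⊆p∪q p ⁅ y ⁆ (x∈⁅x⁆ y)

∈p∪⁅y⁆-elim : {p : Subset m} {y : Fin m} (P : Fin m → Set) →
  (∀ {x} → x ∈ p → P x) → P y → ∀ {x} → x ∈ p ∪ ⁅ y ⁆ → P x
∈p∪⁅y⁆-elim {p = p} {y} P onP onY {x} x∈ with x∈p∪q⁻ p ⁅ y ⁆ x∈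
... | inj₁ x∈p = onP x∈p
... | inj₂ x∈⁅y⁆ = subst P (≡-sym (x∈⁅y⁆⇒x≡y y x∈⁅y⁆)) onY

x∈p⇒⁅x⁆⊆p : {p : Subset m} {x : Fin m} → x ∈ p → ⁅ x ⁆ ⊆ p
x∈p⇒⁅x⁆⊆p {p = p} {x} x∈p y∈⁅x⁆ = subst (_∈ p) (≡-sym (x∈⁅y⁆⇒x≡y x y∈⁅x⁆)) x∈p

∪-least : {p q r : Subset m} → p ⊆ r → q ⊆ r → p ∪ q ⊆ r
∪-least {p = p} {q} p⊆r q⊆r x∈ = [ p⊆r , q⊆r ] (x∈p∪q⁻ p q x∈)

∪-monoʳ-⊆ : (p : Subset m) {q q′ : Subset m} → q ⊆ q′ → p ∪ q ⊆ p ∪ q′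
∪-monoʳ-⊆ p {q} q⊆q′ x∈ = [ p⊆p∪q _ , (λ x∈q → q⊆p∪q p _ (q⊆q′ x∈q)) ] (x∈p∪q⁻ p q x∈)

x∉p∪q : {p q : Subset m} {x : Fin m} → x ∉ p → x ∉ q → x ∉ p ∪ q
x∉p∪q {p = p} {q} x∉p x∉q x∈ = [ x∉p , x∉q ] (x∈p∪q⁻ p q x∈)

module _ {G : Graph} {X : Subset (n G)} where

  walk-head : ∀ {u v} → WalkIn G X u v → u ∈ X
  walk-head (here u∈X)     = u∈X
  walk-head (step u∈X _ _) = u∈X

  walk-first-neighbour : ∀ {u v} → WalkIn G X u v → u ≢ v → ∃ λ w → w ∈ X × Adj G u w
  walk-first-neighbour (here _)       u≢u = contradiction refl u≢u
  walk-first-neighbour (step _ u~w w) _   = _ , walk-head w , u~w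

  walk-++ : ∀ {u v w} → WalkIn G X u v → WalkIn G X v w → WalkIn G X u w
  walk-++ (here _)         w₂ = w₂
  walk-++ (step u∈X u~w w) w₂ = step u∈X u~w (walk-++ w w₂)

  walk-reverse : ∀ {u v} → WalkIn G X u v → WalkIn G X v u
  walk-reverse (here u∈X)         = here u∈X
  walk-reverse (step u∈X u~w w) = walk-++ (walk-reverse w) (step (walk-head w) (sym G u~w) (here u∈X))

  connected-if-rooted : (r : Fin (n G)) → (∀ {u} → u ∈ X → WalkIn G X u r) → Connected G X
  connected-if-rooted r to-r u v u∈X v∈X = walk-++ (to-r u∈X) (walk-reverse (to-r v∈X))

walk-mono : ∀ {G : Graph} {X Y : Subset (n G)} {u v} → X ⊆ Y → WalkIn G X u v → WalkIn G Y u v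
walk-mono X⊆Y (here u∈X)       = here (X⊆Y u∈X)
walk-mono X⊆Y (step u∈X u~w w) = step (X⊆Y u∈X) u~w (walk-mono X⊆Y w)

minimal-extension-⊆ : ∀ {G : Graph} {I O S B : Subset (n G)} →
  MinimalExtension G I O S → B ⊆ S → Extension G I O B → S ⊆ B
minimal-extension-⊆ {B = B} (_ , minimal) B⊆S B-ext {x} x∈S with x ∈? B
... | yes x∈B = x∈B
... | no  x∉B = contradiction B-ext (minimal B (B⊆S , x , x∈S , x∉B))

module SubExtension (G : Graph) (I O S : Subset (n G))
  (I∩O-empty : Disjoint I O)
  (I∪O-edgeless : EdgelessOn G (I ∪ O)) (outside-edgeless : EdgelessOutside G (I ∪ O))
  (S-extension : Extension G I O S)
  (r : Fin (n G)) (r∈I : r ∈ I)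
  where

  V : ℕ
  V = n G

  T : Subset V
  T = I ∪ O

  I∪S-dominating : Dominating G (I ∪ S)
  I∪S-dominating = proj₁ (proj₂ S-extension)

  I∪S-connected : Connected G (I ∪ S)
  I∪S-connected = proj₂ (proj₂ S-extension)

  ∈I⇒∈T : ∀ {x} → x ∈ I → x ∈ T
  ∈I⇒∈T = p⊆p∪q O

  ∈O⇒∈T : ∀ {x} → x ∈ O → x ∈ T
  ∈O⇒∈T = q⊆p∪q I O

  ∈S⇒∉T : ∀ {x} → x ∈ S → x ∉ T
  ∈S⇒∉T x∈S x∈T = proj₁ S-extension (_ , x∈p∩q⁺ (x∈S , x∈T))

  ∈I⇒∉O : ∀ {x} → x ∈ I → x ∉ O
  ∈I⇒∉O x∈I x∈O = I∩O-empty (_ , x∈p∩q⁺ (x∈I , x∈O))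

  I-neighbour-in-I∪S-is-in-S : ∀ {x w} → x ∈ I → Adj G x w → w ∈ I ∪ S → w ∈ S
  I-neighbour-in-I∪S-is-in-S {x} {w} x∈I x~w w∈I∪S with x∈p∪q⁻ I S w∈I∪S
  ... | inj₁ w∈I = contradiction x~w (I∪O-edgeless x w (∈I⇒∈T x∈I) (∈I⇒∈T w∈I))
  ... | inj₂ w∈S = w∈S

  outsider-neighbour-in-I∪S-is-in-I : ∀ {v u} → v ∉ T → Adj G v u → u ∈ I ∪ S → u ∈ I
  outsider-neighbour-in-I∪S-is-in-I {v} {u} v∉T v~u u∈I∪S with x∈p∪q⁻ I S u∈I∪S
  ... | inj₁ u∈I = u∈I
  ... | inj₂ u∈S = contradiction v~u (outside-edgeless v u v∉T (∈S⇒∉T u∈S))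

  outsider-has-I-neighbour : ∀ {v} → v ∉ T → ∃ λ u → u ∈ I × Adj G v u
  outsider-has-I-neighbour {v} v∉T = I-neighbour I∪S-neighbour
    where
    I-neighbour : (∃ λ u → u ∈ I ∪ S × Adj G v u) → ∃ λ u → u ∈ I × Adj G v u
    I-neighbour (u , u∈I∪S , v~u) = u , outsider-neighbour-in-I∪S-is-in-I v∉T v~u u∈I∪S , v~u

    I∪S-neighbour : ∃ λ u → u ∈ I ∪ S × Adj G v u
    I∪S-neighbour with v ∈? S
    ... | yes v∈S = walk-first-neighbour (I∪S-connected v r (q⊆p∪q I S v∈S) (p⊆p∪q S r∈I))
                      (λ { refl → v∉T (∈I⇒∈T r∈I) })
    ... | no  v∉S = I∪S-dominating v (x∉p∪q (λ v∈I → v∉T (∈I⇒∈T v∈I)) v∉S)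

  Attachment : Subset V → Fin V → Set
  Attachment C a = ∃ λ s → s ∈ S × Adj G a s × ∃ λ a′ → a′ ∈ I × a′ ∈ C × Adj G s a′

  Attachable : Subset V → Fin V → Set
  Attachable C a = a ∈ T × a ∉ C × Attachment C a

  attachable? : ∀ C → Dec (∃ (Attachable C))
  attachable? C = any? λ a → (a ∈? T) ×-dec ¬? (a ∈? C) ×-dec any? λ s →
    (s ∈? S) ×-dec adj? G a s ×-dec any? λ a′ → (a′ ∈? I) ×-dec (a′ ∈? C) ×-dec adj? G s a′

  record Cover (C B : Subset V) : Set where
    field
      C⊆T           : C ⊆ T
      B⊆S           : B ⊆ S
      ∣B∣≤∣C∣       : ∣ B ∣ ≤ ∣ C ∣
      r∈C           : r ∈ C
      B-reaches-r   : ∀ {v} → v ∈ B → WalkIn G (I ∪ B) v r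
      I∩C-reaches-r : ∀ {v} → v ∈ I → v ∈ C → WalkIn G (I ∪ B) v r
      O∩C-dominated : ∀ {o} → o ∈ O → o ∈ C → ∃ λ s → s ∈ B × Adj G o s

  cover-root : Cover ⁅ r ⁆ ⊥
  cover-root = record
    { C⊆T           = x∈p⇒⁅x⁆⊆p (∈I⇒∈T r∈I)
    ; B⊆S           = λ x∈⊥ → contradiction x∈⊥ ∉⊥
    ; ∣B∣≤∣C∣       = p⊆q⇒∣p∣≤∣q∣ (⊥⊆ {p = ⁅ r ⁆})
    ; r∈C           = x∈⁅x⁆ r
    ; B-reaches-r   = λ v∈⊥ → contradiction v∈⊥ ∉⊥
    ; I∩C-reaches-r = λ v∈I v∈⁅r⁆ → subst (λ v → WalkIn G (I ∪ ⊥) v r) (≡-sym (x∈⁅y⁆⇒x≡y r v∈⁅r⁆)) (here (p⊆p∪q ⊥ r∈I))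
    ; O∩C-dominated = λ o∈O o∈⁅r⁆ → contradiction (subst (_∈ O) (x∈⁅y⁆⇒x≡y r o∈⁅r⁆) o∈O) (∈I⇒∉O r∈I)
    }

  cover-attach : ∀ {C B a s} → Cover C B → a ∈ T → a ∉ C → s ∈ S → Adj G a s →
    (∃ λ a′ → a′ ∈ I × a′ ∈ C × Adj G s a′) → Cover (C ∪ ⁅ a ⁆) (B ∪ ⁅ s ⁆)
  cover-attach {C} {B} {a} {s} cover a∈T a∉C s∈S a~s (a′ , a′∈I , a′∈C , s~a′) = record
    { C⊆T           = ∪-least C⊆T (x∈p⇒⁅x⁆⊆p a∈T)
    ; B⊆S           = ∪-least B⊆S (x∈p⇒⁅x⁆⊆p s∈S)
    ; ∣B∣≤∣C∣       = ≤-trans (∣p∪⁅x⁆∣≤1+∣p∣ B s) (≤-trans (s≤s ∣B∣≤∣C∣) (x∉p⇒∣p∣<∣p∪⁅x⁆∣ a∉C))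
    ; r∈C           = p⊆p∪q ⁅ a ⁆ r∈C
    ; B-reaches-r   = ∈p∪⁅y⁆-elim (λ v → WalkIn G (I ∪ B′) v r) (λ v∈B → widen (B-reaches-r v∈B)) s-reaches-r
    ; I∩C-reaches-r = λ v∈I v∈C′ → ∈p∪⁅y⁆-elim (λ v → v ∈ I → WalkIn G (I ∪ B′) v r)
                                      (λ v∈C v∈I → widen (I∩C-reaches-r v∈I v∈C))
                                      (λ a∈I → step (p⊆p∪q B′ a∈I) a~s s-reaches-r) v∈C′ v∈I
    ; O∩C-dominated = λ o∈O o∈C′ → ∈p∪⁅y⁆-elim (λ o → o ∈ O → ∃ λ s′ → s′ ∈ B′ × Adj G o s′)
                                      (λ o∈C o∈O → let (s′ , s′∈B , o~s′) = O∩C-dominated o∈O o∈C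
                                                   in s′ , p⊆p∪q ⁅ s ⁆ s′∈B , o~s′)
                                      (λ _ → s , y∈p∪⁅y⁆ , a~s) o∈C′ o∈O
    }
    where
    open Cover cover
    B′ = B ∪ ⁅ s ⁆

    widen : ∀ {v} → WalkIn G (I ∪ B) v r → WalkIn G (I ∪ B′) v r
    widen = walk-mono (∪-monoʳ-⊆ I (p⊆p∪q ⁅ s ⁆))

    s-reaches-r : WalkIn G (I ∪ B′) s r
    s-reaches-r = step (q⊆p∪q I B′ y∈p∪⁅y⁆) s~a′ (widen (I∩C-reaches-r a′∈I a′∈C))

  module _ {C B : Subset V} (cover : Cover C B) (unattachable : ¬ ∃ (Attachable C)) where
    open Cover cover

    in-C-unless-attachable : ∀ {a} → a ∈ T → Attachment C a → a ∈ C
    in-C-unless-attachable {a} a∈T attachment with a ∈? C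
    ... | yes a∈C = a∈C
    ... | no  a∉C = contradiction (a , a∈T , a∉C , attachment) unattachable

    -- Induction along a walk to r in G[I ∪ S], which alternates between I and S.
    unattachable⇒I⊆C : I ⊆ C
    unattachable⇒I⊆C x∈I = reaches-C x∈I (I∪S-connected _ r (p⊆p∪q S x∈I) (p⊆p∪q S r∈I))
      where
      reaches-C : ∀ {x} → x ∈ I → WalkIn G (I ∪ S) x r → x ∈ C
      reaches-C x∈I (here _) = r∈C
      reaches-C x∈I (step _ x~w rest) with I-neighbour-in-I∪S-is-in-S x∈I x~w (walk-head rest) | rest
      ... | w∈S | here _ = contradiction (∈I⇒∈T r∈I) (∈S⇒∉T w∈S)
      ... | w∈S | step _ w~x′ rest′ =
        let x′∈I = outsider-neighbour-in-I∪S-is-in-I (∈S⇒∉T w∈S) w~x′ (walk-head rest′)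
        in in-C-unless-attachable (∈I⇒∈T x∈I) (_ , w∈S , x~w , _ , x′∈I , reaches-C x′∈I rest′ , w~x′)

    unattachable⇒O⊆C : O ⊆ C
    unattachable⇒O⊆C {o} o∈O with I∪S-dominating o (x∉p∪q (λ o∈I → ∈I⇒∉O o∈I o∈O) (λ o∈S → ∈S⇒∉T o∈S (∈O⇒∈T o∈O)))
    ... | u , u∈I∪S , o~u with x∈p∪q⁻ I S u∈I∪S
    ...   | inj₁ u∈I = contradiction o~u (I∪O-edgeless o u (∈O⇒∈T o∈O) (∈I⇒∈T u∈I))
    ...   | inj₂ u∈S =
      let (a′ , a′∈I , u~a′) = outsider-has-I-neighbour (∈S⇒∉T u∈S)
      in in-C-unless-attachable (∈O⇒∈T o∈O) (u , u∈S , o~u , a′ , a′∈I , unattachable⇒I⊆C a′∈I , u~a′)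

    unattachable⇒T⊆C : T ⊆ C
    unattachable⇒T⊆C = ∪-least unattachable⇒I⊆C unattachable⇒O⊆C

  -- The fuel k bounds the number of vertices C can still absorb.
  saturate : ∀ k {C B} → Cover C B → V < ∣ C ∣ + k → ∃₂ λ C B → Cover C B × T ⊆ C
  saturate zero {C} _ V<∣C∣ = contradiction (∣p∣≤n C) (<⇒≱ (subst (V <_) (+-identityʳ ∣ C ∣) V<∣C∣))
  saturate (suc k) {C} cover V<∣C∣+1+k with attachable? C
  ... | no  unattachable = C , _ , cover , unattachable⇒T⊆C cover unattachable
  ... | yes (a , a∈T , a∉C , s , s∈S , a~s , link) =
    saturate k (cover-attach cover a∈T a∉C s∈S a~s link)
      (≤-trans (subst (V <_) (+-suc ∣ C ∣ k) V<∣C∣+1+k) (+-monoˡ-≤ k (x∉p⇒∣p∣<∣p∪⁅x⁆∣ a∉C)))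

  cover⇒extension : ∀ {C B} → Cover C B → T ⊆ C → Extension G I O B
  cover⇒extension {C} {B} cover T⊆C = B∩T-empty , dominating , connected-if-rooted r reaches-r
    where
    open Cover cover

    B∩T-empty : Disjoint B T
    B∩T-empty (x , x∈B∩T) = let (x∈B , x∈T) = x∈p∩q⁻ B T x∈B∩T in ∈S⇒∉T (B⊆S x∈B) x∈T

    dominating : Dominating G (I ∪ B)
    dominating v v∉I∪B with v ∈? O
    ... | yes v∈O = let (s , s∈B , v~s) = O∩C-dominated v∈O (T⊆C (∈O⇒∈T v∈O)) in s , q⊆p∪q I B s∈B , v~s
    ... | no  v∉O =
      let (u , u∈I , v~u) = outsider-has-I-neighbour (x∉p∪q (λ v∈I → v∉I∪B (p⊆p∪q B v∈I)) v∉O)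
      in u , p⊆p∪q B u∈I , v~u

    reaches-r : ∀ {u} → u ∈ I ∪ B → WalkIn G (I ∪ B) u r
    reaches-r {u} u∈I∪B with x∈p∪q⁻ I B u∈I∪B
    ... | inj₁ u∈I = I∩C-reaches-r u∈I (T⊆C (∈I⇒∈T u∈I))
    ... | inj₂ u∈B = B-reaches-r u∈B

  small-sub-extension : ∃ λ B → B ⊆ S × Extension G I O B × ∣ B ∣ ≤ ∣ T ∣
  small-sub-extension with saturate V cover-root (subst (λ c → V < c + V) (≡-sym (∣⁅x⁆∣≡1 r)) ≤-refl)
  ... | C , B , cover , T⊆C =
    B , Cover.B⊆S cover , cover⇒extension cover T⊆C , ≤-trans (Cover.∣B∣≤∣C∣ cover) (p⊆q⇒∣p∣≤∣q∣ (Cover.C⊆T cover))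

lemma14 : (G : Graph) → (I O : Subset (n G)) →
    Disjoint I O → Nonempty I →
    EdgelessOn G (I ∪ O) → EdgelessOutside G (I ∪ O) →
    (S : Subset (n G)) → MinimalExtension G I O S →
    ∣ S ∣ ≤ ∣ I ∪ O ∣
lemma14 G I O I∩O-empty (r , r∈I) I∪O-edgeless outside-edgeless S S-minimal@(S-extension , _) =
  let (B , B⊆S , B-extension , ∣B∣≤∣I∪O∣) =
        SubExtension.small-sub-extension G I O S I∩O-empty I∪O-edgeless outside-edgeless S-extension r r∈I
  in ≤-trans (p⊆q⇒∣p∣≤∣q∣ (minimal-extension-⊆ S-minimal B⊆S B-extension)) ∣B∣≤∣I∪O∣
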